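{- Let $G$ be a connected finite simple graph with $\gamma_{gr}^L(G) = 2$. Then for every L-sequence $(x, y)$ of length two in $G$, the vertices $x$ and $y$ are adjacent.
   Context: For a vertex $v$, $N(v)$ is its open neighborhood (the set of its neighbors) and $N[v] = N(v) \cup \{v\}$ its closed neighborhood. An L-sequence of $G$ is a sequence $(v_1, \ldots, v_k)$ of distinct vertices of $G$ such that for every $i \in \{1,\ldots,k\}$, $N[v_i] \setminus \bigcup_{j=1}^{i-1} N(v_j) \neq \emptyset$. The L-Grundy domination number $\gamma_{gr}^L(G)$ is the maximum length of an L-sequence of $G$. -}

module Defs where

open import Data.Nat using (ℕ; _≤_)
open import Data.Fin using (Fin)
open import Data.List using (List; length; take; lookup; _∷_; [])
open import Data.List.Relation.Unary.All using (All)
open import Data.List.Relation.Unary.Unique.Propositional using (Unique)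
open import Data.Product using (Σ; ∃; _×_)
open import Data.Sum using (_⊎_)
open import Relation.Nullary using (¬_)
open import Relation.Binary.PropositionalEquality using (_≡_)
open import Relation.Binary.Construct.Closure.ReflexiveTransitive using (Star)
open import Level using (0ℓ; suc)

record Graph (n : ℕ) : Set₁ where
  field
    Adj     : Fin n → Fin n → Set
    sym     : ∀ {u v} → Adj u v → Adj v u
    irrefl  : ∀ {u} → ¬ Adj u u

open Graph public

Connected : ∀ {n} → Graph n → Set
Connected {n} G = (u v : Fin n) → Star (Adj G) u v

InOpenNbhd : ∀ {n} → Graph n → Fin n → Fin n → Set
InOpenNbhd G w u = Adj G w u

InClosedNbhd : ∀ {n} → Graph n → Fin n → Fin n → Set
InClosedNbhd G v u = (u ≡ v) ⊎ Adj G v u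

Footprints : ∀ {n} → Graph n → List (Fin n) → Fin n → Set
Footprints G prefix v =
  ∃ λ u → InClosedNbhd G v u × All (λ w → ¬ InOpenNbhd G w u) prefix

IsLSeq : ∀ {n} → Graph n → List (Fin n) → Set
IsLSeq G s =
  Unique s × ((i : Fin (length s)) → Footprints G (take (Data.Fin.toℕ i) s) (lookup s i))

LGrundyDomNumberIs : ∀ {n} → Graph n → ℕ → Set
LGrundyDomNumberIs G k =
  (∃ λ s → IsLSeq G s × length s ≡ k) × (∀ s → IsLSeq G s → length s ≤ k)

{-# OPTIONS --safe #-}
module Submission where

-- Let y footprint u with respect to x, so u ∈ N[y] and u ∉ N(x). If u ≠ x, then u
-- followed by x and by any neighbour v of x (which exists by connectivity) is an
-- L-sequence of length three: u footprints itself and x, v both footprint x.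
-- Hence u = x, and u ∈ N[y] with x ≠ y makes x and y adjacent.

open import Defs
open import Data.Nat using (_≤_; s≤s)
open import Data.Fin using (Fin; zero; suc; _≟_; toℕ)
open import Data.List using (_∷_; []; take; lookup)
open import Data.List.Relation.Unary.All using (_∷_; [])
open import Data.List.Relation.Unary.AllPairs using (_∷_; [])
open import Data.Product using (∃; _×_; _,_)
open import Data.Sum using (inj₁; inj₂)
open import Data.Empty using (⊥-elim)
open import Relation.Nullary using (¬_; yes; no)
open import Relation.Binary.PropositionalEquality using (_≡_; _≢_; refl; ≢-sym)
open import Relation.Binary.Construct.Closure.ReflexiveTransitive using (Star; ε; _◅_)

star-departs : ∀ {a ℓ} {A : Set a} {R : A → A → Set ℓ} {x y : A} →
  Star R x y → x ≢ y → ∃ (R x)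
star-departs ε       x≢x = ⊥-elim (x≢x refl)
star-departs (r ◅ _) _   = _ , r

module _ {n} (G : Graph n) where

  IsLSeq-pair⇒footprint : ∀ {x y} → IsLSeq G (x ∷ y ∷ []) →
    x ≢ y × ∃ λ u → InClosedNbhd G y u × ¬ Adj G x u
  IsLSeq-pair⇒footprint (((x≢y ∷ []) ∷ [] ∷ []) , footprint) with footprint (suc zero)
  ... | u , y∼u , (x≁u ∷ []) = x≢y , u , y∼u , x≁u

  IsLSeq-nonneighbour-vertex-neighbour : ∀ {u x v} →
    u ≢ x → ¬ Adj G x u → Adj G x v → IsLSeq G (u ∷ x ∷ v ∷ [])
  IsLSeq-nonneighbour-vertex-neighbour {u} {x} {v} u≢x x≁u x∼v =
    ((u≢x ∷ u≢v ∷ []) ∷ (x≢v ∷ []) ∷ [] ∷ []) , footprint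
    where
    u≢v : u ≢ v
    u≢v refl = x≁u x∼v
    x≢v : x ≢ v
    x≢v refl = irrefl G x∼v
    u≁x : ¬ Adj G u x
    u≁x u∼x = x≁u (sym G u∼x)
    footprint : (i : Fin 3) →
      Footprints G (take (toℕ i) (u ∷ x ∷ v ∷ [])) (lookup (u ∷ x ∷ v ∷ []) i)
    footprint zero             = u , inj₁ refl , []
    footprint (suc zero)       = x , inj₁ refl , u≁x ∷ []
    footprint (suc (suc zero)) = x , inj₂ (sym G x∼v) , u≁x ∷ irrefl G ∷ []

lemma3p1 : ∀ {n} (G : Graph n) → Connected G → LGrundyDomNumberIs G 2 →
    (x y : Fin n) → IsLSeq G (x ∷ y ∷ []) → Adj G x y
lemma3p1 G connected (_ , maximal) x y xy-LSeq
  with IsLSeq-pair⇒footprint G xy-LSeq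
... | x≢y , u , y∼u , x≁u with u ≟ x
...   | yes refl = adjacent y∼u
  where
  adjacent : InClosedNbhd G y x → Adj G x y
  adjacent (inj₁ x≡y) = ⊥-elim (x≢y x≡y)
  adjacent (inj₂ y∼x) = sym G y∼x
...   | no u≢x with star-departs (connected x y) x≢y
...     | _ , x∼v = ⊥-elim (three≰two (maximal _ (IsLSeq-nonneighbour-vertex-neighbour G u≢x x≁u x∼v)))
  where
  three≰two : ¬ (3 ≤ 2)
  three≰two (s≤s (s≤s ()))
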